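{- Let $\alpha,\beta,\gamma\in\mathrm{ord}$. (1) If $\alpha<\sup(\alpha,\beta)$, then $\alpha<\beta$. (2) If $\gamma<\alpha$ and $\alpha\le\sup(\beta,\gamma)$, then $\alpha\le\beta$.
   Context: The setting is constructive. Let $\mathfrak F$ be a set of index sets containing $\mathbb N$ and every $\mathbb N_k=\{n\in\mathbb N:n<k\}$, closed (up to isomorphism) under finitely enumerated subsets, sets of finitely enumerated subsets, and disjoint unions indexed by elements of $\mathfrak F$. The set $\mathrm{ord}=\mathrm{ord}_{\mathfrak F}$ is defined inductively: a distinguished element $\underline 0$, and for every $I\in\mathfrak F$ and family $(\alpha_i)_{i\in I}$ in $\mathrm{ord}$ an element $\mathrm S(\alpha_i)_{i\in I}$; $\mathrm{ord}^*$ is the set of these. For $\alpha=\mathrm S(\alpha_i)_{i\in I}$, $\mathrm{In}_\alpha=I$; by convention $\mathrm{In}_{\underline0}=\emptyset$. For a finite list $F\subseteq_f\mathrm{In}_\alpha$, $\alpha_F$ is the list of the $\alpha_i$, $i\in F$. By simultaneous induction ($m\ge1$): $\alpha\le\beta^1,\dots,\beta^m$ means $\alpha_i<\beta^1,\dots,\beta^m$ for all $i\in\mathrm{In}_\alpha$; $\alpha<\beta^1,\dots,\beta^m$ means there exist $F_k\subseteq_f\mathrm{In}_{\beta^k}$, not all empty, with $\alpha\le\beta^1_{F_1},\dots,\beta^m_{F_m}$; $m=1$ gives binary $\le,<$. For a family $(\alpha^j)_{j\in J}$ in $\mathrm{ord}^*$ with $\alpha^j=\mathrm S((\alpha^j)_i)_{i\in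 I_j}$, $\sup(\alpha^j)_{j\in J}=\mathrm S(\varepsilon_k)_{k\in K}$ where $K$ is the disjoint union of the $I_j$ and $\varepsilon_k=(\alpha^j)_i$ when $k$ is the image of $i\in I_j$; for finitely many elements of $\mathrm{ord}$, $\sup(\alpha^1,\dots,\alpha^r)$ is $\underline0$ if all $\alpha^k=\underline0$, else the sup of those $\alpha^k\in\mathrm{ord}^*$. -}

module Defs where

open import Data.Nat using (ℕ)
open import Data.Fin using (Fin)
open import Data.List using (List; []; _∷_; _++_; map; length; lookup)
open import Data.Product using (Σ; _×_; _,_; proj₁; proj₂)
open import Data.Unit using (⊤; tt)
open import Data.Empty using (⊥)
open import Relation.Nullary using (¬_)
open import Relation.Binary.PropositionalEquality using (_≡_)
open import Function.Bundles using (_↔_; Inverse)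

-- A set 𝔉 of index sets, given as a universe (codes + decoding),
-- containing ℕ and every ℕ_k (rendered as Fin k), and closed up to
-- isomorphism under disjoint unions indexed by elements of 𝔉.
record IndexSets : Set₁ where
  field
    Code  : Set
    El    : Code → Set
    natC  : Code
    natI  : El natC ↔ ℕ
    finC  : ℕ → Code
    finI  : (k : ℕ) → El (finC k) ↔ Fin k
    sigC  : (c : Code) → (El c → Code) → Code
    sigI  : (c : Code) (ι : El c → Code) → El (sigC c ι) ↔ Σ (El c) (λ j → El (ι j))

module Ordinals (𝔉 : IndexSets) where
  open IndexSets 𝔉

  data Ord : Set where
    0̲ : Ord
    S  : (c : Code) → (El c → Ord) → Ord

  In : Ord → Set
  In 0̲      = ⊥
  In (S c f) = El c

  comp : (α : Ord) → In α → Ord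
  comp 0̲ ()
  comp (S c f) i = f i

  compL : (α : Ord) → List (In α) → List Ord
  compL α F = map (comp α) F

  Choice : List Ord → Set
  Choice []       = ⊤
  Choice (β ∷ βs) = List (In β) × Choice βs

  flat : (βs : List Ord) → Choice βs → List Ord
  flat []       tt       = []
  flat (β ∷ βs) (F , Fs) = compL β F ++ flat βs Fs

  AllEmpty : (βs : List Ord) → Choice βs → Set
  AllEmpty []       tt       = ⊤
  AllEmpty (β ∷ βs) (F , Fs) = (F ≡ []) × AllEmpty βs Fs

  mutual
    data _≤ₘ_ : Ord → List Ord → Set where
      le : ∀ {α βs} → ((i : In α) → comp α i <ₘ βs) → α ≤ₘ βs

    data _<ₘ_ : Ord → List Ord → Set where
      lt : ∀ {α βs} (Fs : Choice βs) → ¬ AllEmpty βs Fs → α ≤ₘ flat βs Fs → α <ₘ βs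

  _≤_ : Ord → Ord → Set
  α ≤ β = α ≤ₘ (β ∷ [])

  _<_ : Ord → Ord → Set
  α < β = α <ₘ (β ∷ [])

  -- elements of ord* presented by their index code and family
  Ord* : Set
  Ord* = Σ Code (λ c → El c → Ord)

  supFam : (J : Code) → (El J → Ord*) → Ord
  supFam J a = S (sigC J (λ j → proj₁ (a j)))
                 (λ k → let p = Inverse.to (sigI J (λ j → proj₁ (a j))) k
                        in proj₂ (a (proj₁ p)) (proj₂ p))

  nonzero : List Ord → List Ord*
  nonzero []          = []
  nonzero (0̲ ∷ αs)    = nonzero αs
  nonzero (S c f ∷ αs) = (c , f) ∷ nonzero αs

  supNZ : List Ord* → Ord
  supNZ []       = 0̲
  supNZ (a ∷ as) = supFam (finC (length (a ∷ as)))
                     (λ j → lookup (a ∷ as) (Inverse.to (finI (length (a ∷ as))) j))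

  sup : List Ord → Ord
  sup αs = supNZ (nonzero αs)

{-# OPTIONS --safe #-}
module Submission where

-- The relations α ≤ β¹,…,βᵐ and α < β¹,…,βᵐ see the βᵏ only through the components they
-- offer, and they are transitive.  The heart of both statements is that an ordinal never
-- profits from its own components in an upper bound: if every member of Φ is ≤ Ψ ++ qs, where
-- Ψ consists of components of Φ, then every member of Φ is already ≤ qs.  This holds by
-- well-founded induction on finite lists ordered by "is a nonempty list of components of".
-- In (1) the components of sup(α, β) are those of α and of β, and those of α are dropped;
-- in (2) γ < α replaces γ in sup(β, γ) by components of α, which are dropped again.

open import Defs
open import Data.List using (List; []; _∷_; _++_; lookup; length)
open import Data.List.Membership.Propositional using (_∈_)
open import Data.List.Membership.Propositional.Properties using (∈-++⁺ʳ; ∈-++⁻; ∈-lookup)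
open import Data.List.Relation.Binary.Subset.Propositional using (_⊆_)
open import Data.List.Relation.Binary.Subset.Propositional.Properties
  using (xs⊆x∷xs; xs⊆xs++ys; xs⊆ys++xs; ∷⁺ʳ; ∈-∷⁺ʳ; ++⁺ʳ)
open import Data.List.Relation.Unary.All as All using (All; []; _∷_)
open import Data.List.Relation.Unary.All.Properties using (++⁺; map⁺)
open import Data.List.Relation.Unary.Any using (here; there)
open import Data.Product using (∃-syntax; ∃₂; _×_; _,_; proj₁; proj₂)
open import Data.Sum using (_⊎_; inj₁; inj₂; [_,_]′)
open import Data.Empty using (⊥-elim)
open import Data.Unit using (tt)
open import Relation.Nullary using (¬_)
open import Relation.Binary.PropositionalEquality using (refl)
open import Induction.WellFounded using (Acc; acc)
open import Function using (_∘_; id)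
open import Function.Bundles using (Inverse)

module _ (𝔉 : IndexSets) where
  open IndexSets 𝔉
  open Ordinals 𝔉

  private variable
    α x w : Ord
    βs γs qs ws u v Φ Ψ : List Ord

  NonEmpty : List Ord → Set
  NonEmpty xs = ∃[ x ] x ∈ xs

  NonEmpty-⊆ : ws ⊆ v → NonEmpty ws → NonEmpty v
  NonEmpty-⊆ sub (x , m) = x , sub m

  NonEmpty-++⁻ : ∀ u → NonEmpty (u ++ v) → NonEmpty u ⊎ NonEmpty v
  NonEmpty-++⁻ u (x , m) with ∈-++⁻ u m
  ... | inj₁ m′ = inj₁ (x , m′)
  ... | inj₂ m′ = inj₂ (x , m′)

  data Components (βs : List Ord) : Ord → Set where
    component : ∀ {β} → β ∈ βs → (i : In β) → Components βs (comp β i)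

  Components-⊆ : βs ⊆ γs → Components βs w → Components γs w
  Components-⊆ sub (component m i) = component (sub m) i

  Components-++⁻ : ∀ βs → Components (βs ++ γs) w → Components βs w ⊎ Components γs w
  Components-++⁻ βs (component m i) with ∈-++⁻ βs m
  ... | inj₁ m′ = inj₁ (component m′ i)
  ... | inj₂ m′ = inj₂ (component m′ i)

  Components-nonEmpty : Components βs w → NonEmpty βs
  Components-nonEmpty (component m _) = _ , m

  Components-split : ∀ βs → All (Components (βs ++ γs)) ws →
    ∃₂ λ u v → All (Components βs) u × All (Components γs) v × ws ⊆ u ++ v
  Components-split βs [] = [] , [] , [] , [] , λ ()
  Components-split βs (_∷_ {x = w} c cs) with Components-++⁻ βs c | Components-split βs cs
  ... | inj₁ cu | u , v , cus , cvs , sub =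
    w ∷ u , v , cu ∷ cus , cvs , ∷⁺ʳ w sub
  ... | inj₂ cv | u , v , cus , cvs , sub =
    u , w ∷ v , cus , cv ∷ cvs , ∈-∷⁺ʳ (∈-++⁺ʳ u (here refl)) (++⁺ʳ u (xs⊆x∷xs v w) ∘ sub)

  -- α ≤ β¹,…,βᵐ and α < β¹,…,βᵐ, with the chosen components recorded as a list
  -- rather than as one index list per βᵏ.
  mutual
    data _≼_ (α : Ord) (βs : List Ord) : Set where
      ≼-intro : ((i : In α) → comp α i ≺ βs) → α ≼ βs

    data _≺_ (α : Ord) (βs : List Ord) : Set where
      ≺-intro : ∀ ws → NonEmpty ws → All (Components βs) ws → α ≼ ws → α ≺ βs

  ≼-component : α ≼ βs → (i : In α) → comp α i ≺ βs
  ≼-component (≼-intro h) = h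

  ≺-nonEmpty : α ≺ βs → NonEmpty βs
  ≺-nonEmpty (≺-intro _ (_ , m) cs _) = Components-nonEmpty (All.lookup cs m)

  ≺-mono : (∀ {w} → Components βs w → Components γs w) → α ≺ βs → α ≺ γs
  ≺-mono sub (≺-intro ws ne cs α≼ws) = ≺-intro ws ne (All.map sub cs) α≼ws

  ≼-mono : (∀ {w} → Components βs w → Components γs w) → α ≼ βs → α ≼ γs
  ≼-mono sub (≼-intro h) = ≼-intro (≺-mono sub ∘ h)

  ≼-⊆ : βs ⊆ γs → α ≼ βs → α ≼ γs
  ≼-⊆ sub = ≼-mono (Components-⊆ sub)

  ≼-refl : ∀ α → α ≼ (α ∷ [])
  ≼-refl 0̲       = ≼-intro λ ()
  ≼-refl (S c f) = ≼-intro λ i →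
    ≺-intro (f i ∷ []) (_ , here refl) (component (here refl) i ∷ []) (≼-refl (f i))

  ∈⇒≼ : x ∈ βs → x ≼ βs
  ∈⇒≼ m = ≼-⊆ (λ { (here refl) → m }) (≼-refl _)

  Components⇒≼ : ∀ x → Components βs x → x ≼ βs
  Components⇒≼ 0̲       _ = ≼-intro λ ()
  Components⇒≼ (S c f) x∈ = ≼-intro λ j →
    ≺-intro (S c f ∷ []) (_ , here refl) (x∈ ∷ []) (Components⇒≼ (f j) (component (here refl) j))

  Components-≺ : All (_≼ γs) βs → Components βs x → x ≺ γs
  Components-≺ βs≼ (component m i) = ≼-component (All.lookup βs≼ m) i

  ≺-gather : All (_≺ γs) ws →
    ∃[ v ] All (Components γs) v × (NonEmpty ws → NonEmpty v) × All (_≼ v) ws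
  ≺-gather [] = [] , [] , (λ { (_ , ()) }) , []
  ≺-gather (≺-intro u ne cs w≼u ∷ rest) with ≺-gather rest
  ... | v , cvs , _ , ws≼v =
    u ++ v , ++⁺ cs cvs , (λ _ → NonEmpty-⊆ (xs⊆xs++ys u v) ne) ,
    ≼-⊆ (xs⊆xs++ys u v) w≼u ∷ All.map (≼-⊆ (xs⊆ys++xs v u)) ws≼v

  mutual
    ≼-trans : α ≼ βs → All (_≼ γs) βs → α ≼ γs
    ≼-trans {0̲}     _           _   = ≼-intro λ ()
    ≼-trans {S c f} (≼-intro h) βs≼ = ≼-intro λ i → ≺-trans (h i) βs≼

    ≺-trans : α ≺ βs → All (_≼ γs) βs → α ≺ γs
    ≺-trans (≺-intro ws ne cs α≼ws) βs≼ with ≺-gather (All.map (Components-≺ βs≼) cs)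
    ... | v , cvs , ne⇒ , ws≼v = ≺-intro v (ne⇒ ne) cvs (≼-trans α≼ws ws≼v)

  _⊏_ : List Ord → List Ord → Set
  Ψ ⊏ Φ = NonEmpty Ψ × All (Components Φ) Ψ

  acc-⊆ : Ψ ⊆ Φ → Acc _⊏_ Φ → Acc _⊏_ Ψ
  acc-⊆ sub (acc rs) = acc λ (ne , cs) → rs (ne , All.map (Components-⊆ sub) cs)

  acc-[] : Acc _⊏_ []
  acc-[] = acc λ { ((_ , ()) , []) ; (_ , component () _ ∷ _) }

  acc-++ : Acc _⊏_ Φ → Acc _⊏_ Ψ → Acc _⊏_ (Φ ++ Ψ)
  acc-++ {Φ} {Ψ} (acc rs₁) (acc rs₂) = acc step
    where
    step : ws ⊏ (Φ ++ Ψ) → Acc _⊏_ ws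
    step (ne , cs) with Components-split Φ cs
    ... | []      , []      , _   , _   , sub with () ← proj₂ (NonEmpty-⊆ sub ne)
    ... | []      , v ∷ vs  , _   , cvs , sub = acc-⊆ sub (rs₂ ((v , here refl) , cvs))
    ... | u ∷ us  , []      , cus , _   , sub =
      acc-⊆ (λ m → [ id , (λ ()) ]′ (∈-++⁻ (u ∷ us) (sub m))) (rs₁ ((u , here refl) , cus))
    ... | u ∷ us  , v ∷ vs  , cus , cvs , sub =
      acc-⊆ sub (acc-++ (rs₁ ((u , here refl) , cus)) (rs₂ ((v , here refl) , cvs)))

  mutual
    acc-[_] : ∀ α → Acc _⊏_ (α ∷ [])
    acc-[ α ] = acc λ (_ , cs) → acc-All (All.map (Components-acc α) cs)

    Components-acc : ∀ α → Components (α ∷ []) x → Acc _⊏_ (x ∷ [])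
    Components-acc (S c f) (component (here refl) i) = acc-[ f i ]

    acc-All : All (λ x → Acc _⊏_ (x ∷ [])) Ψ → Acc _⊏_ Ψ
    acc-All []       = acc-[]
    acc-All (a ∷ as) = acc-++ a (acc-All as)

  -- Each ψ ∈ Ψ is a component of some φ ≼ Ψ ++ qs, so it is bounded by components of Ψ and
  -- of qs; the induction hypothesis at Ψ drops the former, giving Ψ ≼ qs, and transitivity
  -- then removes Ψ from the bound of Φ.
  ≼-drop-own-components : Acc _⊏_ Φ → All (Components Φ) Ψ → All (_≼ (Ψ ++ qs)) Φ → All (_≼ qs) Φ
  ≼-drop-own-components _ [] Φ≼ = Φ≼
  ≼-drop-own-components {Ψ = Ψ@(ψ ∷ _)} {qs} (acc rs) cs Φ≼ =
    All.map (λ φ≼ → ≼-trans φ≼ (++⁺ Ψ≼qs (All.tabulate ∈⇒≼))) Φ≼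
    where
    Ψ≼qs : All (_≼ qs) Ψ
    Ψ≼qs with ≺-gather (All.map (Components-≺ Φ≼) cs)
    ... | W , cWs , _ , Ψ≼W with Components-split Ψ cWs
    ... | U , V , cUs , cVs , W⊆ =
      All.map (λ ψ≼V → ≼-trans ψ≼V (All.map (Components⇒≼ _) cVs))
        (≼-drop-own-components (rs ((ψ , here refl) , cs)) cUs (All.map (≼-⊆ W⊆) Ψ≼W))

  flat-Components : ∀ βs (Fs : Choice βs) → All (Components βs) (flat βs Fs)
  flat-Components []       tt       = []
  flat-Components (β ∷ βs) (F , Fs) =
    ++⁺ (map⁺ (All.tabulate λ {j} _ → component (here refl) j))
        (All.map (Components-⊆ (xs⊆x∷xs βs β)) (flat-Components βs Fs))

  flat-nonEmpty : ∀ βs (Fs : Choice βs) → ¬ AllEmpty βs Fs → NonEmpty (flat βs Fs)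
  flat-nonEmpty []       tt           ¬e = ⊥-elim (¬e tt)
  flat-nonEmpty (β ∷ βs) ([] , Fs)    ¬e = flat-nonEmpty βs Fs (λ e → ¬e (refl , e))
  flat-nonEmpty (β ∷ βs) (j ∷ _ , _)  _  = comp β j , here refl

  nonEmpty⇒¬AllEmpty : ∀ βs (Fs : Choice βs) → NonEmpty (flat βs Fs) → ¬ AllEmpty βs Fs
  nonEmpty⇒¬AllEmpty []       tt         (_ , ())
  nonEmpty⇒¬AllEmpty (β ∷ βs) ([] , Fs)  ne (_ , e) = nonEmpty⇒¬AllEmpty βs Fs ne e
  nonEmpty⇒¬AllEmpty (β ∷ βs) (_ ∷ _ , _) _  (() , _)

  emptyChoice : ∀ βs → Choice βs
  emptyChoice []       = tt
  emptyChoice (β ∷ βs) = [] , emptyChoice βs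

  insert : ∀ {β} → β ∈ βs → In β → Choice βs → Choice βs
  insert (here refl) i (F , Fs) = i ∷ F , Fs
  insert (there m)   i (F , Fs) = F , insert m i Fs

  flat-insert : ∀ {β} (m : β ∈ βs) (i : In β) (Fs : Choice βs) →
    comp β i ∷ flat βs Fs ⊆ flat βs (insert m i Fs)
  flat-insert (here refl) _ _ = id
  flat-insert {γ ∷ _} (there m) i (F , Fs) =
    ∈-∷⁺ʳ (∈-++⁺ʳ (compL γ F) (flat-insert m i Fs (here refl)))
          (++⁺ʳ (compL γ F) (flat-insert m i Fs ∘ there))

  choose : All (Components βs) ws → ∃[ Fs ] ws ⊆ flat βs Fs
  choose {βs} []         = emptyChoice βs , λ ()
  choose (component m i ∷ cs) with choose cs
  ... | Fs , sub = insert m i Fs , flat-insert m i Fs ∘ ∷⁺ʳ _ sub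

  mutual
    ≤ₘ⇒≼ : α ≤ₘ βs → α ≼ βs
    ≤ₘ⇒≼ (le h) = ≼-intro λ i → <ₘ⇒≺ (h i)

    <ₘ⇒≺ : α <ₘ βs → α ≺ βs
    <ₘ⇒≺ {βs = βs} (lt Fs ¬e α≤) =
      ≺-intro (flat βs Fs) (flat-nonEmpty βs Fs ¬e) (flat-Components βs Fs) (≤ₘ⇒≼ α≤)

  mutual
    ≼⇒≤ₘ : α ≼ βs → α ≤ₘ βs
    ≼⇒≤ₘ {0̲}     _           = le λ ()
    ≼⇒≤ₘ {S c f} (≼-intro h) = le λ i → ≺⇒<ₘ {f i} (h i)

    ≺⇒<ₘ : α ≺ βs → α <ₘ βs
    ≺⇒<ₘ {α} {βs} (≺-intro ws ne cs α≼ws) with choose cs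
    ... | Fs , ws⊆ =
      lt Fs (nonEmpty⇒¬AllEmpty βs Fs (NonEmpty-⊆ ws⊆ ne)) (≼⇒≤ₘ {α} (≼-⊆ ws⊆ α≼ws))

  nonzero-∈ : ∀ αs {a : Ord*} → a ∈ nonzero αs → S (proj₁ a) (proj₂ a) ∈ αs
  nonzero-∈ (0̲ ∷ αs)     m           = there (nonzero-∈ αs m)
  nonzero-∈ (S c f ∷ αs) (here refl) = here refl
  nonzero-∈ (S c f ∷ αs) (there m)   = there (nonzero-∈ αs m)

  supFam-Components : ∀ J (A : El J → Ord*) → (∀ j → S (proj₁ (A j)) (proj₂ (A j)) ∈ βs) →
    (k : In (supFam J A)) → Components βs (comp (supFam J A) k)
  supFam-Components J A emb k with Inverse.to (sigI J (λ j → proj₁ (A j))) k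
  ... | j , i = component (emb j) i

  supNZ-Components : ∀ as → (∀ {a} → a ∈ as → S (proj₁ a) (proj₂ a) ∈ βs) →
    (k : In (supNZ as)) → Components βs (comp (supNZ as) k)
  supNZ-Components as@(_ ∷ _) emb =
    supFam-Components (finC (length as)) (lookup as ∘ Inverse.to (finI (length as)))
      (λ j → emb (∈-lookup (Inverse.to (finI (length as)) j)))

  sup-Components : ∀ αs → Components (sup αs ∷ []) w → Components αs w
  sup-Components αs (component (here refl) k) = supNZ-Components (nonzero αs) (nonzero-∈ αs) k

  α<supαβ⇒α<β : ∀ α β → α < sup (α ∷ β ∷ []) → α < β
  α<supαβ⇒α<β α β α<sup with ≺-mono (sup-Components (α ∷ β ∷ [])) (<ₘ⇒≺ α<sup)
  ... | ≺-intro ws ne cs α≼ws with Components-split (α ∷ []) cs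
  ... | u , v , cus , cvs , ws⊆ = ≺⇒<ₘ (≺-intro v v-nonEmpty cvs α≼v)
    where
    α≼v : α ≼ v
    α≼v = All.head (≼-drop-own-components acc-[ α ] cus (≼-⊆ ws⊆ α≼ws ∷ []))
    v-nonEmpty : NonEmpty v
    v-nonEmpty with NonEmpty-++⁻ u (NonEmpty-⊆ ws⊆ ne)
    ... | inj₁ (_ , m) = ≺-nonEmpty (Components-≺ (α≼v ∷ []) (All.lookup cus m))
    ... | inj₂ ne′ = ne′

  γ<α⇒α≤supβγ⇒α≤β : ∀ α β γ → γ < α → α ≤ sup (β ∷ γ ∷ []) → α ≤ β
  γ<α⇒α≤supβγ⇒α≤β α β γ γ<α α≤sup with <ₘ⇒≺ γ<α
  ... | ≺-intro ws _ cs γ≼ws =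
    ≼⇒≤ₘ (All.head (≼-drop-own-components acc-[ α ] cs (α≼ws++β ∷ [])))
    where
    α≼ws++β : α ≼ (ws ++ β ∷ [])
    α≼ws++β = ≼-trans (≼-mono (sup-Components (β ∷ γ ∷ [])) (≤ₘ⇒≼ α≤sup))
      (∈⇒≼ (∈-++⁺ʳ ws (here refl)) ∷ ≼-⊆ (xs⊆xs++ys ws (β ∷ [])) γ≼ws ∷ [])

lemma4p7 : (𝔉 : IndexSets) → let open Ordinals 𝔉 in
    (α β γ : Ord) →
      ((α < sup (α ∷ β ∷ []) → α < β)
      × (γ < α → α ≤ sup (β ∷ γ ∷ []) → α ≤ β))
lemma4p7 𝔉 α β γ = α<supαβ⇒α<β 𝔉 α β , γ<α⇒α≤supβγ⇒α≤β 𝔉 α β γ
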